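{- Let $X$ be a festoon and $C\in\mathcal C_G$. Then $|\delta_X(C)|\le 4$.
   Context: Setting: a cycle $G=(V,E)$ with root $r$ and an edge $e_r\in E$ incident to $r$; links are unordered vertex pairs. $\mathcal C_G=\{C\subseteq V\setminus\{r\}:|\delta_E(C)|=2\}$; $\delta_X(C)$ = links of $X$ with exactly one endpoint in $C$. Number $V=\{r=v_0,\dots,v_{n-1}\}$ along the path $(V,E\setminus\{e_r\})$ from $r$; $v_i$ is left of $v_j$ if $i<j$. $\mathrm{left}(\ell),\mathrm{right}(\ell)$ are the left and right endpoints of link $\ell$. Two links intersect if they share an endpoint or cross (share no endpoint and each of the two paths of $G$ between the endpoints of one contains an endpoint of the other); $H[X]$ has vertex set $X$ and edges between intersecting links. $X$ is a festoon if $H[X]$ is a path whose links, numbered $\ell_1,\dots,\ell_p$ in path order, satisfy for all $i<j$: $\mathrm{left}(\ell_i)$ left of $\mathrm{left}(\ell_j)$ and $\mathrm{right}(\ell_i)$ left of $\mathrm{right}(\ell_j)$. -}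

module Defs where

open import Data.Nat using (ℕ; zero; suc; _+_; _≤_)
open import Data.Nat.DivMod using (_mod_)
open import Data.Fin using (Fin; toℕ) renaming (_<_ to _<ᶠ_; zero to fzero)
open import Data.Bool using (Bool; true; false; _xor_; if_then_else_)
open import Data.Product using (Σ; ∃; _×_; _,_; proj₁; proj₂)
open import Data.Sum using (_⊎_)
open import Data.List using (List; []; _∷_)
open import Data.List.Membership.Propositional using (_∈_)
open import Data.List.Relation.Unary.All using (All)
open import Relation.Binary.PropositionalEquality using (_≡_; _≢_)
open import Relation.Nullary using (¬_)
open import Function.Bundles using (_⇔_)
open import Function.Definitions using (Injective)

-- The cycle G has vertex set V = Fin (suc n) = {v_0, …, v_n}, root r = v_0 = fzero.
-- Edges: {v_i, v_{i+1 mod (n+1)}} for every i; e_r = {v_n, v_0}, so that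
-- (V, E ∖ {e_r}) is the path v_0 – v_1 – … – v_n, and the index order is "left of".

Vertex : ℕ → Set
Vertex n = Fin (suc n)

root : ∀ {n} → Vertex n
root = fzero

next : ∀ {n} → Vertex n → Vertex n
next {n} i = suc (toℕ i) mod (suc n)

VSet : ℕ → Set
VSet n = Vertex n → Bool

countFin : ∀ {m} → (Fin m → Bool) → ℕ
countFin {zero}  f = 0
countFin {suc m} f = (if f fzero then 1 else 0) + countFin (λ i → f (Data.Fin.suc i))

cutE : ∀ {n} → VSet n → ℕ
cutE C = countFin (λ i → C i xor C (next i))

InCG : ∀ {n} → VSet n → Set
InCG C = (C root ≡ false) × (cutE C ≡ 2)

-- A link is an unordered pair of distinct vertices, stored as (left, right)
-- with left strictly left of right.
Link : ℕ → Set
Link n = Vertex n × Vertex n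

left right : ∀ {n} → Link n → Vertex n
left  = proj₁
right = proj₂

ValidLink : ∀ {n} → Link n → Set
ValidLink ℓ = left ℓ <ᶠ right ℓ

StrictlyInside : ∀ {n} → Vertex n → Vertex n → Vertex n → Set
StrictlyInside a b v = (a <ᶠ v) × (v <ᶠ b)

-- vertex v lies on the other path of G between a and b (through e_r), minus a,b
StrictlyOutside : ∀ {n} → Vertex n → Vertex n → Vertex n → Set
StrictlyOutside a b v = (v <ᶠ a) ⊎ (b <ᶠ v)

ShareEndpoint : ∀ {n} → Link n → Link n → Set
ShareEndpoint (a , b) (c , d) = (a ≡ c) ⊎ (a ≡ d) ⊎ (b ≡ c) ⊎ (b ≡ d)

-- crossing: no common endpoint and each of the two a–b paths of G
-- contains an endpoint of the other link
Cross : ∀ {n} → Link n → Link n → Set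
Cross ℓ@(a , b) m@(c , d) =
  ¬ ShareEndpoint ℓ m
  × (StrictlyInside a b c ⊎ StrictlyInside a b d)
  × (StrictlyOutside a b c ⊎ StrictlyOutside a b d)

Intersect : ∀ {n} → Link n → Link n → Set
Intersect ℓ m = ShareEndpoint ℓ m ⊎ Cross ℓ m

-- X (a duplicate-free list of links) is a festoon: there is a numbering
-- ℓ_1,…,ℓ_p of X (a bijection Fin p → X) which is a path order of H[X]
-- (distinct links intersect iff they are consecutive) and both endpoints
-- increase strictly along the numbering.
IsFestoon : ∀ {n} → List (Link n) → Set
IsFestoon {n} X =
  Σ ℕ λ p → Σ (Fin p → Link n) λ ℓ →
    (∀ l → (l ∈ X) ⇔ (∃ λ i → ℓ i ≡ l))
    × Injective _≡_ _≡_ ℓ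
    × (∀ i j → i ≢ j →
         Intersect (ℓ i) (ℓ j) ⇔ ((toℕ j ≡ suc (toℕ i)) ⊎ (toℕ i ≡ suc (toℕ j))))
    × (∀ i j → i <ᶠ j →
         (left (ℓ i) <ᶠ left (ℓ j)) × (right (ℓ i) <ᶠ right (ℓ j)))

deltaX : ∀ {n} → List (Link n) → VSet n → ℕ
deltaX []       C = 0
deltaX (ℓ ∷ X) C = (if C (left ℓ) xor C (right ℓ) then 1 else 0) + deltaX X C

-- Since r ∉ C and exactly two cycle edges have one endpoint in C, C is an interval of the
-- path v₀ – … – vₙ avoiding v₀: membership in C cannot alternate out, in, out, in along the
-- path, as that would produce three boundary edges. So two links of δ_X(C) that both enter C
-- from the left, or both leave it to the right, are interleaved when listed in festoon order,
-- hence cross. Intersecting links of a festoon have consecutive positions, and no three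
-- positions are pairwise consecutive (look at their parities), so each kind contributes at
-- most two links.

module Submission where

open import Defs
open import Data.List.Relation.Unary.Unique.Propositional using (Unique)
open import Data.Nat using (ℕ; _≤_; zero; suc; parity; _+_; _∸_; _<_; z≤n; s≤s; s≤s⁻¹)
open import Data.Nat.Properties as ℕ using (≤-trans; m≤n+m; +-suc; m∸n+n≡m; +-mono-≤; module ≤-Reasoning)
open import Data.Nat.DivMod using (m<n⇒m%n≡m)
open import Data.Parity.Base using (_⁻¹)
open import Data.Parity.Properties using (suc-homo-⁻¹; ⁻¹-selfInverse; ⁻¹-involutive; p≢p⁻¹)
open import Data.Fin using (Fin; toℕ) renaming (zero to fzero; suc to fsuc; _<_ to _<ᶠ_; _≤_ to _≤ᶠ_)
open import Data.Fin.Properties using (toℕ-injective; toℕ-fromℕ<; toℕ≤pred[n]; <-cmp; <-irrefl; <-trans)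
open import Data.Bool using (Bool; true; false; _xor_)
import Data.Bool.Properties as Bool
open import Data.Product using (_×_; _,_; proj₁; ∃-syntax; uncurry)
open import Data.Sum using (_⊎_; inj₁; inj₂) renaming (swap to ⊎-swap)
open import Data.List using (List; _∷_; []; length; filter)
open import Data.List.Membership.Propositional using (_∈_)
open import Data.List.Membership.Propositional.Properties using (∈-filter⁻)
open import Data.List.Relation.Unary.Any using (here; there)
open import Data.List.Relation.Unary.All as All using (All; _∷_)
open import Data.List.Relation.Unary.AllPairs using (_∷_)
open import Data.List.Relation.Unary.Unique.Propositional.Properties using (filter⁺)
open import Data.Empty using (⊥; ⊥-elim)
open import Function using (_∘_)
open import Function.Bundles using (Equivalence)
open import Relation.Binary.Definitions using (tri<; tri≈; tri>)
open import Relation.Binary.PropositionalEquality using (_≡_; _≢_; ≢-sym; refl; sym; trans; cong; subst; module ≡-Reasoning)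
open import Relation.Nullary using (¬_; yes; no)
open import Relation.Nullary.Decidable using (_×-dec_)
open import Relation.Unary using (Pred; Decidable)
open import Level using (0ℓ)

countFin-≥1 : ∀ {m} (f : Fin m → Bool) {i} → f i ≡ true → 1 ≤ countFin f
countFin-≥1 f {fzero}  fi rewrite fi = s≤s z≤n
countFin-≥1 f {fsuc i} fi = ≤-trans (countFin-≥1 (f ∘ fsuc) fi) (m≤n+m _ _)

countFin-≥2 : ∀ {m} (f : Fin m → Bool) {i j} → i <ᶠ j → f i ≡ true → f j ≡ true → 2 ≤ countFin f
countFin-≥2 f {fzero}  {fsuc j} _   fi fj rewrite fi = s≤s (countFin-≥1 (f ∘ fsuc) fj)
countFin-≥2 f {fsuc i} {fsuc j} i<j fi fj =
  ≤-trans (countFin-≥2 (f ∘ fsuc) (s≤s⁻¹ i<j) fi fj) (m≤n+m _ _)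

countFin-≥3 : ∀ {m} (f : Fin m → Bool) {i j k} → i <ᶠ j → j <ᶠ k →
              f i ≡ true → f j ≡ true → f k ≡ true → 3 ≤ countFin f
countFin-≥3 f {fzero}  {fsuc j} {fsuc k} _   j<k fi fj fk rewrite fi =
  s≤s (countFin-≥2 (f ∘ fsuc) (s≤s⁻¹ j<k) fj fk)
countFin-≥3 f {fsuc i} {fsuc j} {fsuc k} i<j j<k fi fj fk =
  ≤-trans (countFin-≥3 (f ∘ fsuc) (s≤s⁻¹ i<j) (s≤s⁻¹ j<k) fi fj fk) (m≤n+m _ _)

≢⇒xor≡true : ∀ {a b : Bool} → a ≢ b → a xor b ≡ true
≢⇒xor≡true {false} {false} a≢b = ⊥-elim (a≢b refl)
≢⇒xor≡true {false} {true}  _   = refl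
≢⇒xor≡true {true}  {false} _   = refl
≢⇒xor≡true {true}  {true}  a≢b = ⊥-elim (a≢b refl)

toℕ-next : ∀ {n} (x : Vertex n) → toℕ x < n → toℕ (next x) ≡ suc (toℕ x)
toℕ-next x x<n = trans (toℕ-fromℕ< _) (m<n⇒m%n≡m (s≤s x<n))

<-at-distance : ∀ {n} d {x y : Vertex n} → toℕ y ≡ suc (d + toℕ x) → x <ᶠ y
<-at-distance d {x} y≡ = subst (toℕ x <_) (sym y≡) (s≤s (m≤n+m _ d))

module _ {n : ℕ} (C : VSet n) where
  open ≡-Reasoning

  IsBoundary : Vertex n → Set
  IsBoundary i = C i xor C (next i) ≡ true

  boundary-between-at-distance : ∀ d {x y : Vertex n} → toℕ y ≡ suc (d + toℕ x) → C x ≢ C y →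
                                 ∃[ i ] x ≤ᶠ i × i <ᶠ y × IsBoundary i
  boundary-between-at-distance d {x} {y} y≡ Cx≢Cy
    with C x Bool.≟ C (next x) | toℕ-next x (ℕ.<-≤-trans (<-at-distance d y≡) (toℕ≤pred[n] y))
  ... | no Cx≢Cx′ | _ = x , ℕ.≤-refl , <-at-distance d y≡ , ≢⇒xor≡true Cx≢Cx′
  ... | yes Cx≡Cx′ | x′≡1+x with d
  ...   | zero = ⊥-elim (Cx≢Cy (trans Cx≡Cx′ (cong C (toℕ-injective (trans x′≡1+x (sym y≡))))))
  ...   | suc d′ with boundary-between-at-distance d′ {next x} {y} y≡′ (Cx≢Cy ∘ trans Cx≡Cx′)
    where y≡′ : toℕ y ≡ suc (d′ + toℕ (next x))
          y≡′ = begin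
            toℕ y                       ≡⟨ y≡ ⟩
            suc (suc (d′ + toℕ x))      ≡⟨ cong suc (+-suc d′ (toℕ x)) ⟨
            suc (d′ + suc (toℕ x))      ≡⟨ cong (λ k → suc (d′ + k)) x′≡1+x ⟨
            suc (d′ + toℕ (next x))     ∎
  ...     | i , x′≤i , i<y , bi = i , ℕ.≤-trans (ℕ.n≤1+n _) (subst (_≤ toℕ i) x′≡1+x x′≤i) , i<y , bi

  boundary-between : ∀ {x y : Vertex n} → x <ᶠ y → C x ≢ C y → ∃[ i ] x ≤ᶠ i × i <ᶠ y × IsBoundary i
  boundary-between {x} {y} x<y =
    boundary-between-at-distance (toℕ y ∸ suc (toℕ x)) (trans (sym (m∸n+n≡m x<y)) (+-suc _ _))

  alternation⇒cutE≥3 : ∀ {x₀ x₁ x₂ x₃ : Vertex n} → x₀ <ᶠ x₁ → x₁ <ᶠ x₂ → x₂ <ᶠ x₃ →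
                       C x₀ ≢ C x₁ → C x₁ ≢ C x₂ → C x₂ ≢ C x₃ → 3 ≤ cutE C
  alternation⇒cutE≥3 x₀<x₁ x₁<x₂ x₂<x₃ C₀≢C₁ C₁≢C₂ C₂≢C₃
    with boundary-between x₀<x₁ C₀≢C₁ | boundary-between x₁<x₂ C₁≢C₂ | boundary-between x₂<x₃ C₂≢C₃
  ... | i , _ , i<x₁ , bi | j , x₁≤j , j<x₂ , bj | k , x₂≤k , _ , bk =
    countFin-≥3 _ (ℕ.<-≤-trans i<x₁ x₁≤j) (ℕ.<-≤-trans j<x₂ x₂≤k) bi bj bk

Enters Leaves : ∀ {n} → VSet n → Pred (Link n) 0ℓ
Enters C ℓ = C (left ℓ) ≡ false × C (right ℓ) ≡ true
Leaves C ℓ = C (left ℓ) ≡ true × C (right ℓ) ≡ false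

enters? : ∀ {n} (C : VSet n) → Decidable (Enters C)
enters? C ℓ = C (left ℓ) Bool.≟ false ×-dec C (right ℓ) Bool.≟ true

leaves? : ∀ {n} (C : VSet n) → Decidable (Leaves C)
leaves? C ℓ = C (left ℓ) Bool.≟ true ×-dec C (right ℓ) Bool.≟ false

deltaX≡entering+leaving : ∀ {n} (C : VSet n) (X : List (Link n)) →
                          deltaX X C ≡ length (filter (enters? C) X) + length (filter (leaves? C) X)
deltaX≡entering+leaving C [] = refl
deltaX≡entering+leaving C (ℓ ∷ X) with C (left ℓ) | C (right ℓ)
... | false | false = deltaX≡entering+leaving C X
... | false | true  = cong suc (deltaX≡entering+leaving C X)
... | true  | false = trans (cong suc (deltaX≡entering+leaving C X)) (sym (+-suc _ _))
... | true  | true  = deltaX≡entering+leaving C X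

interleaved⇒Cross : ∀ {n} {a b c d : Vertex n} → a <ᶠ c → c <ᶠ b → b <ᶠ d → Cross (a , b) (c , d)
interleaved⇒Cross a<c c<b b<d = no-common-endpoint , inj₁ (a<c , c<b) , inj₂ (inj₂ b<d)
  where
    no-common-endpoint : ¬ ShareEndpoint _ _
    no-common-endpoint (inj₁ a≡c)               = <-irrefl a≡c a<c
    no-common-endpoint (inj₂ (inj₁ a≡d))        = <-irrefl a≡d (<-trans a<c (<-trans c<b b<d))
    no-common-endpoint (inj₂ (inj₂ (inj₁ b≡c))) = <-irrefl (sym b≡c) c<b
    no-common-endpoint (inj₂ (inj₂ (inj₂ b≡d))) = <-irrefl b≡d b<d

≡false⇒≡true⇒≢ : ∀ {x y : Bool} → x ≡ false → y ≡ true → x ≢ y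
≡false⇒≡true⇒≢ refl refl ()

module _ {n : ℕ} {C : VSet n} (root∉C : C root ≡ false) (cut≡2 : cutE C ≡ 2) where

  no-alternation : ∀ {x₀ x₁ x₂ x₃ : Vertex n} → x₀ <ᶠ x₁ → x₁ <ᶠ x₂ → x₂ <ᶠ x₃ →
                   C x₀ ≢ C x₁ → C x₁ ≢ C x₂ → C x₂ ≢ C x₃ → ⊥
  no-alternation x₀<x₁ x₁<x₂ x₂<x₃ C₀≢C₁ C₁≢C₂ C₂≢C₃ =
    ℕ.n≮n 2 (subst (3 ≤_) cut≡2 (alternation⇒cutE≥3 C x₀<x₁ x₁<x₂ x₂<x₃ C₀≢C₁ C₁≢C₂ C₂≢C₃))

  root<ᶠ : ∀ {v : Vertex n} → C v ≡ true → root {n} <ᶠ v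
  root<ᶠ {fzero}  Cv = ⊥-elim (≡false⇒≡true⇒≢ root∉C Cv refl)
  root<ᶠ {fsuc _} _  = s≤s z≤n

  entering-links-cross : ∀ {ℓ m : Link n} → ValidLink ℓ → ValidLink m →
                         left ℓ <ᶠ left m → right ℓ <ᶠ right m → Enters C ℓ → Enters C m → Cross ℓ m
  entering-links-cross {a , b} {c , d} a<b c<d a<c b<d (Ca , Cb) (Cc , Cd) with <-cmp c b
  ... | tri< c<b _ _  = interleaved⇒Cross a<c c<b b<d
  ... | tri≈ _ refl _ = ⊥-elim (≡false⇒≡true⇒≢ Cc Cb refl)
  ... | tri> _ _ b<c  =
    ⊥-elim (no-alternation a<b b<c c<d
              (≡false⇒≡true⇒≢ Ca Cb) (≢-sym (≡false⇒≡true⇒≢ Cc Cb)) (≡false⇒≡true⇒≢ Cc Cd))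

  leaving-links-cross : ∀ {ℓ m : Link n} → ValidLink ℓ → ValidLink m →
                        left ℓ <ᶠ left m → right ℓ <ᶠ right m → Leaves C ℓ → Leaves C m → Cross ℓ m
  leaving-links-cross {a , b} {c , d} a<b _ a<c b<d (Ca , Cb) (Cc , Cd) with <-cmp c b
  ... | tri< c<b _ _  = interleaved⇒Cross a<c c<b b<d
  ... | tri≈ _ refl _ = ⊥-elim (≡false⇒≡true⇒≢ Cb Cc refl)
  ... | tri> _ _ b<c  =
    ⊥-elim (no-alternation (root<ᶠ Ca) a<b b<c
              (≡false⇒≡true⇒≢ root∉C Ca) (≢-sym (≡false⇒≡true⇒≢ Cb Ca)) (≡false⇒≡true⇒≢ Cb Cc))

Adjacent : ℕ → ℕ → Set
Adjacent i j = (j ≡ suc i) ⊎ (i ≡ suc j)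

Adjacent⇒parity≡⁻¹ : ∀ {i j} → Adjacent i j → parity i ≡ parity j ⁻¹
Adjacent⇒parity≡⁻¹ {i}     (inj₁ refl) = sym (suc-homo-⁻¹ i)
Adjacent⇒parity≡⁻¹ {j = j} (inj₂ refl) = sym (⁻¹-selfInverse (suc-homo-⁻¹ j))

no-Adjacent-triangle : ∀ {i j k} → Adjacent i j → Adjacent j k → Adjacent i k → ⊥
no-Adjacent-triangle {i} {j} {k} ij jk ik = p≢p⁻¹ (parity k) (begin
  parity k          ≡⟨ ⁻¹-involutive (parity k) ⟨
  parity k ⁻¹ ⁻¹    ≡⟨ cong _⁻¹ (Adjacent⇒parity≡⁻¹ jk) ⟨
  parity j ⁻¹       ≡⟨ Adjacent⇒parity≡⁻¹ ij ⟨
  parity i          ≡⟨ Adjacent⇒parity≡⁻¹ ik ⟩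
  parity k ⁻¹       ∎)
  where open ≡-Reasoning

festoon-clique-length≤2 : ∀ {n} {X : List (Link n)} → IsFestoon X →
  (ys : List (Link n)) → Unique ys → (∀ {ℓ} → ℓ ∈ ys → ℓ ∈ X) →
  (∀ {ℓ m} → ℓ ∈ ys → m ∈ ys → left ℓ <ᶠ left m → right ℓ <ᶠ right m → Intersect ℓ m) →
  length ys ≤ 2
festoon-clique-length≤2 _ []           _ _ _ = z≤n
festoon-clique-length≤2 _ (_ ∷ [])     _ _ _ = s≤s z≤n
festoon-clique-length≤2 _ (_ ∷ _ ∷ []) _ _ _ = s≤s (s≤s z≤n)
festoon-clique-length≤2 (p , ℓ , mem , _ , intersect⇔adjacent , increasing)
  ys@(x ∷ y ∷ z ∷ _) ((x≢y ∷ x≢z ∷ _) ∷ (y≢z ∷ _) ∷ _) ys⊆X ordered-intersect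
  with index (here refl) | index (there (here refl)) | index (there (there (here refl)))
  where
    index : ∀ {l} → l ∈ ys → ∃[ i ] ℓ i ≡ l
    index l∈ys = Equivalence.to (mem _) (ys⊆X l∈ys)
... | i , refl | j , refl | k , refl =
  ⊥-elim (no-Adjacent-triangle
    (adjacent (here refl) (there (here refl)) x≢y)
    (adjacent (there (here refl)) (there (there (here refl))) y≢z)
    (adjacent (here refl) (there (there (here refl))) x≢z))
  where
    adjacent : ∀ {i j} → ℓ i ∈ ys → ℓ j ∈ ys → ℓ i ≢ ℓ j → Adjacent (toℕ i) (toℕ j)
    adjacent {i} {j} ℓi∈ ℓj∈ ℓi≢ℓj with <-cmp i j
    ... | tri< i<j _ _  = Equivalence.to (intersect⇔adjacent i j (ℓi≢ℓj ∘ cong ℓ))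
                            (uncurry (ordered-intersect ℓi∈ ℓj∈) (increasing i j i<j))
    ... | tri≈ _ refl _ = ⊥-elim (ℓi≢ℓj refl)
    ... | tri> _ _ j<i  = ⊎-swap (Equivalence.to (intersect⇔adjacent j i (ℓi≢ℓj ∘ cong ℓ ∘ sym))
                            (uncurry (ordered-intersect ℓj∈ ℓi∈) (increasing j i j<i)))

festoon-filter-length≤2 : ∀ {n} {X : List (Link n)} → All ValidLink X → Unique X → IsFestoon X →
  ∀ {P : Pred (Link n) 0ℓ} (P? : Decidable P) →
  (∀ {ℓ m} → ValidLink ℓ → ValidLink m → left ℓ <ᶠ left m → right ℓ <ᶠ right m → P ℓ → P m → Cross ℓ m) →
  length (filter P? X) ≤ 2
festoon-filter-length≤2 {X = X} valid unique festoon P? ordered-cross =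
  festoon-clique-length≤2 festoon (filter P? X) (filter⁺ P? unique) (proj₁ ∘ ∈-filter⁻ P?) ordered-intersect
  where
    ordered-intersect : ∀ {ℓ m} → ℓ ∈ filter P? X → m ∈ filter P? X →
                        left ℓ <ᶠ left m → right ℓ <ᶠ right m → Intersect ℓ m
    ordered-intersect ℓ∈ m∈ with ∈-filter⁻ P? ℓ∈ | ∈-filter⁻ P? m∈
    ... | ℓ∈X , Pℓ | m∈X , Pm = λ lefts< rights< →
      inj₂ (ordered-cross (All.lookup valid ℓ∈X) (All.lookup valid m∈X) lefts< rights< Pℓ Pm)

lemma35 : (n : ℕ) → 2 ≤ n →
          (X : List (Link n)) → All ValidLink X → Unique X → IsFestoon X →
          (C : VSet n) → InCG C →
          deltaX X C ≤ 4
lemma35 n _ X valid unique festoon C (root∉C , cut≡2) = begin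
  deltaX X C                                                     ≡⟨ deltaX≡entering+leaving C X ⟩
  length (filter (enters? C) X) + length (filter (leaves? C) X)  ≤⟨ +-mono-≤ entering≤2 leaving≤2 ⟩
  2 + 2                                                          ∎
  where
    open ≤-Reasoning
    entering≤2 : length (filter (enters? C) X) ≤ 2
    entering≤2 = festoon-filter-length≤2 valid unique festoon (enters? C) (entering-links-cross root∉C cut≡2)
    leaving≤2 : length (filter (leaves? C) X) ≤ 2
    leaving≤2 = festoon-filter-length≤2 valid unique festoon (leaves? C) (leaving-links-cross root∉C cut≡2)
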